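{- Let $\Gamma$ be a triangulation of a connected closed $2$-dimensional surface $M$ and let $\tau$ be a $z$-orientation of $\Gamma$. Then for every vertex of type II, the number of edges of type II which enter this vertex (with respect to the direction induced by $\tau$) equals the number of edges of type II which leave it.
   Context: Let $M$ be a connected closed $2$-dimensional surface (not necessarily orientable). A triangulation $\Gamma$ of $M$ is a $2$-cell embedding of a connected simple finite graph in $M$ all of whose faces are triangles; every edge lies in exactly two distinct faces and two distinct faces meet in an edge, a vertex, or not at all. A zigzag in $\Gamma$ is a sequence of edges $(e_i)_{i\in\mathbb N}$ such that for every $i$: $e_i$ and $e_{i+1}$ are distinct edges of some face; the faces containing $e_i,e_{i+1}$ and $e_{i+1},e_{i+2}$ are distinct; and $e_i$, $e_{i+2}$ have no common vertex. A zigzag is periodic and is regarded as a cyclic sequence $e_1,\dots,e_n$ with $n$ minimal; the reversed sequence $Z^{ -1}$ is also a zigzag and $Z\neq Z^{ -1}$. A zigzag traverses each of its edges $e_i$ in a direction: from the common vertex of $e_{i-1},e_i$ to the common vertex of $e_i,e_{i+1}$. If $\Gamma$ has exactly $k$ zigzags up to reversal, a $z$-orientation $\tau$ is a set of $k$ zigzags containing exactly one of $Z,Z^{ -1}$ for each zigzag $Z$. Each edge $e$ then occurs exactly twice in total among the zigzags of $\tau$ (twice in one zigzag and in no other, or once in each of two distinct zigzags and in no other); $e$ is of type I if these two occurrences traverse $e$ in opposite directions and of type II if in the same direction; an edge of type II is given that common direction. A vertex is of type I if all edges containing it are of type I; otherwise it is of type II. -}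

module Defs where

open import Data.Nat using (ℕ; zero; suc; _+_; _∸_; _<_; _≤_)
open import Data.Nat.DivMod using (_mod_)
open import Data.Fin using (Fin; toℕ; opposite; _≟_)
open import Data.Fin.Properties using (any?)
open import Data.Product using (Σ; ∃; ∃-syntax; _×_; _,_; proj₁; proj₂)
open import Data.Sum using (_⊎_)
open import Data.Empty using (⊥)
open import Relation.Nullary using (¬_; Dec; yes; no; does)
open import Relation.Nullary.Decidable using (_×-dec_; _⊎-dec_; ¬?)
open import Relation.Binary.PropositionalEquality using (_≡_; _≢_)
open import Relation.Binary.Construct.Closure.ReflexiveTransitive using (Star)

count : ∀ {N : ℕ} {P : Fin N → Set} → (∀ i → Dec (P i)) → ℕ
count {zero}  P? = 0
count {suc N} P? with P? Fin.zero
... | yes _ = suc (count {N} (λ i → P? (Fin.suc i)))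
... | no  _ = count {N} (λ i → P? (Fin.suc i))

InTri : ∀ {n} → Fin n → (Fin 3 → Fin n) → Set
InTri x t = ∃[ c ] t c ≡ x

record Triangulation (n m : ℕ) : Set where
  field
    face : Fin m → Fin 3 → Fin n

  _∈F_ : Fin n → Fin m → Set
  x ∈F f = InTri x (face f)

  Adj : Fin n → Fin n → Set
  Adj u v = u ≢ v × ∃[ f ] (u ∈F f × v ∈F f)

  next : ∀ {d} → Fin (3 + d) → Fin (3 + d)
  next {d} i = suc (toℕ i) mod (3 + d)

  field
    face-inj : ∀ f (c c′ : Fin 3) → face f c ≡ face f c′ → c ≡ c′
    -- distinct faces have distinct vertex sets (so two distinct faces
    -- meet in an edge, a vertex, or not at all)
    face-distinct : ∀ f f′ → (∀ x → x ∈F f → x ∈F f′) → f ≡ f′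
    edge-two-faces : ∀ u v → Adj u v →
      ∃[ f₁ ] ∃[ f₂ ] (f₁ ≢ f₂ × (u ∈F f₁ × v ∈F f₁) × (u ∈F f₂ × v ∈F f₂) ×
        (∀ f → u ∈F f → v ∈F f → f ≡ f₁ ⊎ f ≡ f₂))
    -- closed surface: the faces around every vertex v form a single
    -- cycle (the link of v is a circle): they can be listed injectively
    -- as g 0, ..., g (d+2) so that cyclically consecutive faces share an
    -- edge through v
    link-cycle : ∀ v → ∃[ d ] Σ (Fin (3 + d) → Fin m) λ g →
      (∀ i j → g i ≡ g j → i ≡ j) ×
      (∀ i → v ∈F g i) ×
      (∀ f → v ∈F f → ∃[ i ] g i ≡ f) ×
      (∀ i → ∃[ u ] (u ≢ v × u ∈F g i × u ∈F g (next i)))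
    connected : ∀ u v → Star Adj u v

-- Edges are written as pairs of vertices; (a , b) and (b , a) denote
-- the same edge.

Edge : ℕ → Set
Edge n = Fin n × Fin n

_∈E_ : ∀ {n} → Fin n → Edge n → Set
x ∈E (a , b) = x ≡ a ⊎ x ≡ b

SameEdge : ∀ {n} → Edge n → Edge n → Set
SameEdge (a , b) (c , d) = (a ≡ c × b ≡ d) ⊎ (a ≡ d × b ≡ c)

CommonVertex : ∀ {n} → Fin n → Edge n → Edge n → Set
CommonVertex x e e′ = x ∈E e × x ∈E e′

-- Cyclic sequences of edges e_0, ..., e_len-1 (len = suc k), viewed as
-- periodic sequences indexed by ℕ.

record CycSeq (n : ℕ) : Set where
  constructor cyc
  field
    k : ℕ
    seq : Fin (suc k) → Edge n

  len : ℕ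
  len = suc k

  at : ℕ → Edge n
  at i = seq (i mod (suc k))

open CycSeq public

rev : ∀ {n} → CycSeq n → CycSeq n
rev (cyc k s) = cyc k (λ i → s (opposite i))

_≈Z_ : ∀ {n} → CycSeq n → CycSeq n → Set
Z ≈Z Z′ = ∃[ r ] (∀ i → SameEdge (at Z (i + r)) (at Z′ i))

module _ {n m : ℕ} (Γ : Triangulation n m) where
  open Triangulation Γ

  EdgeOf : Edge n → Fin m → Set
  EdgeOf (a , b) f = a ≢ b × a ∈F f × b ∈F f

  TwoEdgesOf : Edge n → Edge n → Fin m → Set
  TwoEdgesOf e e′ f = EdgeOf e f × EdgeOf e′ f × ¬ SameEdge e e′

  ZigzagAt : CycSeq n → ℕ → Set
  ZigzagAt Z i =
    ∃[ f ] ∃[ f′ ] (TwoEdgesOf (at Z i) (at Z (suc i)) f ×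
                    TwoEdgesOf (at Z (suc i)) (at Z (suc (suc i))) f′ ×
                    f ≢ f′) ×
    (∀ x → ¬ CommonVertex x (at Z i) (at Z (suc (suc i))))

  IsZigzag : CycSeq n → Set
  IsZigzag Z = (∀ i → ZigzagAt Z i) ×
    (∀ p → 0 < p → p < len Z → ¬ (∀ i → SameEdge (at Z (i + p)) (at Z i)))

  -- z-orientation: one of Z, Z⁻¹ for each zigzag Z
  IsZOrientation : ∀ {K} → (Fin K → CycSeq n) → Set
  IsZOrientation {K} τ =
    (∀ j → IsZigzag (τ j)) ×
    (∀ j j′ → j ≢ j′ → ¬ (τ j ≈Z τ j′) × ¬ (τ j ≈Z rev (τ j′))) ×
    (∀ Z → IsZigzag Z → ∃[ j ] (Z ≈Z τ j ⊎ Z ≈Z rev (τ j)))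

-- position p of Z traverses its edge from u to v: u is the common vertex
-- of e_{p-1}, e_p and v the common vertex of e_p, e_{p+1}.  We use
-- positions p = len + i (i < len) so that p - 1 is a natural number.
TraversesAt : ∀ {n} → (Z : CycSeq n) → Fin (len Z) → Fin n → Fin n → Set
TraversesAt Z i u v =
  CommonVertex u (at Z (len Z + toℕ i ∸ 1)) (at Z (len Z + toℕ i)) ×
  CommonVertex v (at Z (len Z + toℕ i)) (at Z (suc (len Z + toℕ i)))

∈E? : ∀ {n} (x : Fin n) (e : Edge n) → Dec (x ∈E e)
∈E? x (a , b) = (x ≟ a) ⊎-dec (x ≟ b)

TraversesAt? : ∀ {n} (Z : CycSeq n) i u v → Dec (TraversesAt Z i u v)
TraversesAt? Z i u v =
  (∈E? u _ ×-dec ∈E? u _) ×-dec (∈E? v _ ×-dec ∈E? v _)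

sumFin : ∀ {K} → (Fin K → ℕ) → ℕ
sumFin {zero} g = 0
sumFin {suc K} g = g Fin.zero + sumFin (λ j → g (Fin.suc j))

Occ : ∀ {n K} → (Fin K → CycSeq n) → Fin n → Fin n → ℕ
Occ τ u v = sumFin (λ j → count (λ i → TraversesAt? (τ j) i u v))

module _ {n m : ℕ} (Γ : Triangulation n m) {K : ℕ} (τ : Fin K → CycSeq n) where
  open Triangulation Γ

  TypeI : Fin n → Fin n → Set
  TypeI u v = Adj u v × Occ τ u v ≡ 1 × Occ τ v u ≡ 1

  TypeIIFrom : Fin n → Fin n → Set
  TypeIIFrom u v = Adj u v × Occ τ u v ≡ 2 × Occ τ v u ≡ 0

  VertexTypeII : Fin n → Set
  VertexTypeII v = ¬ (∀ u → Adj u v → TypeI u v)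

  InTri? : ∀ x (t : Fin 3 → Fin n) → Dec (InTri x t)
  InTri? x t = any? (λ c → t c ≟ x)

  Adj? : ∀ u v → Dec (Adj u v)
  Adj? u v = ¬? (u ≟ v) ×-dec any? (λ f → InTri? u (face f) ×-dec InTri? v (face f))

  TypeIIFrom? : ∀ u v → Dec (TypeIIFrom u v)
  TypeIIFrom? u v = Adj? u v ×-dec (Occ τ u v Data.Nat.≟ 2) ×-dec (Occ τ v u Data.Nat.≟ 0)

  #enter : Fin n → ℕ
  #enter v = count (λ u → TypeIIFrom? u v)

  #leave : Fin n → ℕ
  #leave v = count (λ w → TypeIIFrom? v w)

module Submission where

open import Defs
open import Data.Nat as ℕ using (ℕ; zero; suc; _+_; _*_; _∸_; _<_; s≤s; z≤n; NonZero)
open import Data.Nat.Properties using (+-*-semiring; +-commutativeSemigroup; +-identityʳ; *-identityˡ; +-comm; +-assoc; +-suc; +-cancelˡ-≡; *-cancelˡ-≡; *-comm; m∸n+n≡m; m<m+n; <-cmp; m<n⇒0<n∸m; m∸n≤m; ≤-<-trans; m+[n∸m]≡n; <⇒≤; n<1+n)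
open import Data.Nat.DivMod using (_%_; _/_; _mod_; [m+kn]%n≡m%n; m<n⇒m%n≡m; m%n<n; m≡m%n+[m/n]*n)
open import Data.Nat.GeneralisedArithmetic using (fold)
open import Data.Nat.Tactic.RingSolver using (solve-∀)
open import Data.Fin using (Fin; zero; suc; toℕ; punchOut; fromℕ; inject₁; opposite; combine; _≟_)
open import Data.Fin.Properties using (punchOut-injective; suc-injective; toℕ-inject₁; toℕ-fromℕ; toℕ-injective; toℕ-fromℕ<; opposite-prop; toℕ<n; pigeonhole; combine-injective)
open import Data.Product using (Σ; ∃-syntax; ∃₂; _×_; _,_; proj₁; proj₂; uncurry)
open import Data.Product.Properties using (≡-dec)
open import Data.Sum as Sum using (_⊎_; inj₁; inj₂)
open import Data.Empty using (⊥; ⊥-elim)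
open import Function using (_∘_)
open import Relation.Nullary using (¬_; Dec; yes; no)
open import Relation.Nullary.Decidable using (_×-dec_; _⊎-dec_; decidable-stable)
open import Relation.Binary.Definitions using (tri<; tri≈; tri>)
open import Relation.Binary.PropositionalEquality using (_≡_; _≢_; refl; sym; trans; cong; cong₂; subst; subst₂; ≢-sym; module ≡-Reasoning)
open import Algebra.Properties.Semiring.Sum +-*-semiring using (sum; sum-syntax; sum-cong-≗; sum-replicate-zero; sum-init-last; ∑-comm; ∑-distrib-+; *-distribˡ-sum)
open import Algebra.Properties.CommutativeSemigroup +-commutativeSemigroup using (interchange)

-- A zigzag is recorded by its turning vertices, the common vertices of consecutive edges. Three
-- consecutive turning vertices form a window (x , y , z), an oriented triangle of Γ, and the next
-- window (y , z , w) is forced: w is the apex of the other face at yz. This step is injective on a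
-- finite set, so iterating it from any oriented triangle returns, and every oriented triangle is a
-- window of some zigzag. Traversing xy backwards happens in the window (y , x , w′) of the other face
-- at xy, which lies on the reversed zigzag; no zigzag contains both windows of such a flip pair
-- (walking towards each other from them, one would meet a window flipped to itself or to its
-- successor). Since τ contains exactly one of Z, Z⁻¹ for every zigzag Z, each flip pair is visited
-- exactly once by τ. An edge uv lies in two faces, so it carries two flip pairs and is traversed
-- exactly twice in total; it is of type II exactly when both traversals go the same way. Finally
-- every zigzag leaves v as often as it enters it, so summing
--   Occ(u,v) − Occ(v,u) = 2 ([uv of type II towards v] − [vu of type II away from v])
-- over all u gives #enter v = #leave v.

𝟙 : ∀ {P : Set} → Dec P → ℕ
𝟙 (yes _) = 1
𝟙 (no _)  = 0

𝟙-yes : ∀ {P : Set} (P? : Dec P) → P → 𝟙 P? ≡ 1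
𝟙-yes (yes _) _ = refl
𝟙-yes (no ¬p) p = ⊥-elim (¬p p)

𝟙-no : ∀ {P : Set} (P? : Dec P) → ¬ P → 𝟙 P? ≡ 0
𝟙-no (yes p) ¬p = ⊥-elim (¬p p)
𝟙-no (no _)  _  = refl

𝟙-cong : ∀ {P Q : Set} (P? : Dec P) (Q? : Dec Q) → (P → Q) → (Q → P) → 𝟙 P? ≡ 𝟙 Q?
𝟙-cong (yes _) (yes _) _   _   = refl
𝟙-cong (yes p) (no ¬q) p→q _   = ⊥-elim (¬q (p→q p))
𝟙-cong (no ¬p) (yes q) _   q→p = ⊥-elim (¬p (q→p q))
𝟙-cong (no _)  (no _)  _   _   = refl

𝟙-× : ∀ {P Q : Set} (P? : Dec P) (Q? : Dec Q) → 𝟙 (P? ×-dec Q?) ≡ 𝟙 P? * 𝟙 Q?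
𝟙-× (yes _) (yes _) = refl
𝟙-× (yes _) (no _)  = refl
𝟙-× (no _)  _       = refl

𝟙-⊎ : ∀ {P Q : Set} (P? : Dec P) (Q? : Dec Q) → ¬ (P × Q) → 𝟙 (P? ⊎-dec Q?) ≡ 𝟙 P? + 𝟙 Q?
𝟙-⊎ (yes p) (yes q) ¬pq = ⊥-elim (¬pq (p , q))
𝟙-⊎ (yes _) (no _)  _   = refl
𝟙-⊎ (no _)  (yes _) _   = refl
𝟙-⊎ (no _)  (no _)  _   = refl

sumFin≡sum : ∀ {N} (f : Fin N → ℕ) → sumFin f ≡ sum f
sumFin≡sum {zero}  f = refl
sumFin≡sum {suc N} f = cong (f zero +_) (sumFin≡sum (f ∘ suc))

count≡sum : ∀ {N} {P : Fin N → Set} (P? : ∀ i → Dec (P i)) → count P? ≡ sum (𝟙 ∘ P?)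
count≡sum {zero}  P? = refl
count≡sum {suc N} P? with P? zero
... | yes _ = cong suc (count≡sum (P? ∘ suc))
... | no _  = count≡sum (P? ∘ suc)

sum-zero : ∀ {N} (f : Fin N → ℕ) → (∀ i → f i ≡ 0) → sum f ≡ 0
sum-zero {N} f f≡0 = trans (sum-cong-≗ f≡0) (sum-replicate-zero N)

sum-single : ∀ {N} (f : Fin N → ℕ) (i : Fin N) → (∀ j → j ≢ i → f j ≡ 0) → sum f ≡ f i
sum-single f zero    f≡0 = trans (cong (f zero +_) (sum-zero (f ∘ suc) (λ j → f≡0 (suc j) λ ()))) (+-identityʳ _)
sum-single f (suc i) f≡0 = cong₂ _+_ (f≡0 zero λ ())
  (sum-single (f ∘ suc) i (λ j j≢i → f≡0 (suc j) (j≢i ∘ suc-injective)))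

sum-𝟙-unique : ∀ {N} {P : Fin N → Set} (P? : ∀ i → Dec (P i)) (i : Fin N) →
               P i → (∀ j → P j → j ≡ i) → sum (𝟙 ∘ P?) ≡ 1
sum-𝟙-unique P? i p unique =
  trans (sum-single (𝟙 ∘ P?) i (λ j j≢i → 𝟙-no (P? j) (j≢i ∘ unique j))) (𝟙-yes (P? i) p)

sum-δ : ∀ {N} (a : Fin N) (c : ℕ) → sum (λ u → 𝟙 (a ≟ u) * c) ≡ c
sum-δ a c = begin
  sum (λ u → 𝟙 (a ≟ u) * c)  ≡⟨ sum-single _ a (λ u u≢a → cong (_* c) (𝟙-no (a ≟ u) (u≢a ∘ sym))) ⟩
  𝟙 (a ≟ a) * c              ≡⟨ cong (_* c) (𝟙-yes (a ≟ a) refl) ⟩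
  1 * c                      ≡⟨ *-identityˡ c ⟩
  c                          ∎
  where open ≡-Reasoning

sum-rotate : ∀ L (g : ℕ → ℕ) → g L ≡ g 0 → sum {L} (g ∘ suc ∘ toℕ) ≡ sum {L} (g ∘ toℕ)
sum-rotate L g gL≡g0 = +-cancelˡ-≡ (g 0) _ _ (begin
  g 0 + sum {L} (g ∘ suc ∘ toℕ)
    ≡⟨ sum-init-last (g ∘ toℕ) ⟩
  sum {L} (g ∘ toℕ ∘ inject₁) + g (toℕ (fromℕ L))
    ≡⟨ cong₂ _+_ (sum-cong-≗ {L} (cong g ∘ toℕ-inject₁)) (cong g (toℕ-fromℕ L)) ⟩
  sum {L} (g ∘ toℕ) + g L
    ≡⟨ cong (sum {L} (g ∘ toℕ) +_) gL≡g0 ⟩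
  sum {L} (g ∘ toℕ) + g 0
    ≡⟨ +-comm _ (g 0) ⟩
  g 0 + sum {L} (g ∘ toℕ) ∎)
  where open ≡-Reasoning

even-or-odd : ∀ d → ∃[ h ] (d ≡ h + h ⊎ d ≡ suc (h + h))
even-or-odd zero = 0 , inj₁ refl
even-or-odd (suc d) with even-or-odd d
... | h , inj₁ d≡2h   = h , inj₂ (cong suc d≡2h)
... | h , inj₂ d≡2h+1 = suc h , inj₁ (trans (cong suc d≡2h+1) (cong suc (sym (+-suc h h))))

least-witness : ∀ {P : ℕ → Set} → (∀ x → Dec (P x)) → ∀ d → P d → ∃[ l ] (P l × ∀ l′ → l′ < l → ¬ P l′)
least-witness P? zero    p0 = 0 , p0 , λ _ ()
least-witness P? (suc d) pd with P? 0
... | yes p0 = 0 , p0 , λ _ ()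
... | no ¬p0 with least-witness (P? ∘ suc) d pd
...   | l , pl , below = suc l , pl , λ where
          zero    _         → ¬p0
          (suc l′) (s≤s l′<l) → below l′ l′<l

balance-of-two : ∀ a b → a + b ≡ 2 →
                 a + 2 * 𝟙 ((b ℕ.≟ 2) ×-dec (a ℕ.≟ 0)) ≡ b + 2 * 𝟙 ((a ℕ.≟ 2) ×-dec (b ℕ.≟ 0))
balance-of-two 0 .2 refl = refl
balance-of-two 1 .1 refl = refl
balance-of-two 2 .0 refl = refl
balance-of-two (suc (suc (suc a))) b ()

%-complement-unique : ∀ {L} Y Y′ c {u u′} .{{_ : NonZero L}} →
                      Y + c ≡ u * L → Y′ + c ≡ u′ * L → Y % L ≡ Y′ % L
%-complement-unique {L} Y Y′ c {u} {u′} Y+c≡uL Y′+c≡u′L = begin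
  Y % L               ≡⟨ [m+kn]%n≡m%n Y u′ L ⟨
  (Y + u′ * L) % L    ≡⟨ cong (λ t → (Y + t) % L) Y′+c≡u′L ⟨
  (Y + (Y′ + c)) % L  ≡⟨ cong (_% L) (swap Y Y′ c) ⟩
  (Y′ + (Y + c)) % L  ≡⟨ cong (λ t → (Y′ + t) % L) Y+c≡uL ⟩
  (Y′ + u * L) % L    ≡⟨ [m+kn]%n≡m%n Y′ u L ⟩
  Y′ % L              ∎
  where
  open ≡-Reasoning
  swap : ∀ a b c → a + (b + c) ≡ b + (a + c)
  swap a b c = trans (sym (+-assoc a b c)) (trans (cong (_+ c) (+-comm a b)) (+-assoc b a c))

≡-by-two-values : ∀ {A : Set} {v₁ v₂ a b c : A} → a ≡ v₁ ⊎ a ≡ v₂ → b ≡ v₁ ⊎ b ≡ v₂ → c ≡ v₁ ⊎ c ≡ v₂ →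
                  a ≢ c → b ≢ c → a ≡ b
≡-by-two-values (inj₁ refl) (inj₁ refl) _           _   _   = refl
≡-by-two-values (inj₂ refl) (inj₂ refl) _           _   _   = refl
≡-by-two-values (inj₁ refl) (inj₂ refl) (inj₁ refl) a≢c _   = ⊥-elim (a≢c refl)
≡-by-two-values (inj₁ refl) (inj₂ refl) (inj₂ refl) _   b≢c = ⊥-elim (b≢c refl)
≡-by-two-values (inj₂ refl) (inj₁ refl) (inj₁ refl) _   b≢c = ⊥-elim (b≢c refl)
≡-by-two-values (inj₂ refl) (inj₁ refl) (inj₂ refl) a≢c _   = ⊥-elim (a≢c refl)

Fin3-cover : ∀ {a b c : Fin 3} → a ≢ b → a ≢ c → b ≢ c → ∀ d → d ≡ a ⊎ d ≡ b ⊎ d ≡ c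
Fin3-cover {a} {b} {c} a≢b a≢c b≢c d with d ≟ a | d ≟ b | d ≟ c
... | yes d≡a | _       | _       = inj₁ d≡a
... | no _    | yes d≡b | _       = inj₂ (inj₁ d≡b)
... | no _    | no _    | yes d≡c = inj₂ (inj₂ d≡c)
... | no d≢a  | no d≢b  | no d≢c  =
  ⊥-elim (no-three-distinct (distinct d≢a d≢b a≢b) (distinct d≢a d≢c a≢c) (distinct d≢b d≢c b≢c))
  where
  -- Punching out d maps a, b, c to three distinct elements of Fin 2, and punching out one of
  -- those leaves two distinct elements of Fin 1.
  distinct : ∀ {x y} (d≢x : d ≢ x) (d≢y : d ≢ y) → x ≢ y → punchOut d≢x ≢ punchOut d≢y
  distinct d≢x d≢y x≢y = x≢y ∘ punchOut-injective d≢x d≢y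
  no-three-distinct : ∀ {x y z : Fin 2} → x ≢ y → x ≢ z → y ≢ z → ⊥
  no-three-distinct x≢y x≢z y≢z with punchOut x≢y | punchOut x≢z | punchOut-injective x≢y x≢z
  ... | zero | zero | injective = y≢z (injective refl)

Fin3-third : (a b : Fin 3) → ∃[ c ] (c ≢ a × c ≢ b)
Fin3-third zero             zero             = suc zero , (λ ()) , (λ ())
Fin3-third zero             (suc zero)       = suc (suc zero) , (λ ()) , (λ ())
Fin3-third zero             (suc (suc zero)) = suc zero , (λ ()) , (λ ())
Fin3-third (suc zero)       zero             = suc (suc zero) , (λ ()) , (λ ())
Fin3-third (suc zero)       (suc zero)       = zero , (λ ()) , (λ ())
Fin3-third (suc zero)       (suc (suc zero)) = zero , (λ ()) , (λ ())
Fin3-third (suc (suc zero)) zero             = suc zero , (λ ()) , (λ ())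
Fin3-third (suc (suc zero)) (suc zero)       = zero , (λ ()) , (λ ())
Fin3-third (suc (suc zero)) (suc (suc zero)) = zero , (λ ()) , (λ ())

module _ {n : ℕ} where

  SameEdge-sym : ∀ {e e′ : Edge n} → SameEdge e e′ → SameEdge e′ e
  SameEdge-sym (inj₁ (refl , refl)) = inj₁ (refl , refl)
  SameEdge-sym (inj₂ (refl , refl)) = inj₂ (refl , refl)

  SameEdge-trans : ∀ {e e′ e″ : Edge n} → SameEdge e e′ → SameEdge e′ e″ → SameEdge e e″
  SameEdge-trans (inj₁ (refl , refl)) q                    = q
  SameEdge-trans (inj₂ (refl , refl)) (inj₁ (refl , refl)) = inj₂ (refl , refl)
  SameEdge-trans (inj₂ (refl , refl)) (inj₂ (refl , refl)) = inj₁ (refl , refl)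

  ∈E-resp-SameEdge : ∀ {x : Fin n} {e e′} → SameEdge e e′ → x ∈E e → x ∈E e′
  ∈E-resp-SameEdge (inj₁ (refl , refl)) x∈e        = x∈e
  ∈E-resp-SameEdge (inj₂ (refl , refl)) (inj₁ x≡a) = inj₂ x≡a
  ∈E-resp-SameEdge (inj₂ (refl , refl)) (inj₂ x≡b) = inj₁ x≡b

  SameEdge-endpoints : ∀ {x y : Fin n} {e} → x ≢ y → x ∈E e → y ∈E e → SameEdge e (x , y)
  SameEdge-endpoints x≢y (inj₁ refl) (inj₁ refl) = ⊥-elim (x≢y refl)
  SameEdge-endpoints x≢y (inj₁ refl) (inj₂ refl) = inj₁ (refl , refl)
  SameEdge-endpoints x≢y (inj₂ refl) (inj₁ refl) = inj₂ (refl , refl)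
  SameEdge-endpoints x≢y (inj₂ refl) (inj₂ refl) = ⊥-elim (x≢y refl)

  CommonVertex-unique : ∀ {x y : Fin n} {e e′} → ¬ SameEdge e e′ →
                        CommonVertex x e e′ → CommonVertex y e e′ → x ≡ y
  CommonVertex-unique {x} {y} e≠e′ (x∈e , x∈e′) (y∈e , y∈e′) = decidable-stable (x ≟ y) λ x≢y →
    e≠e′ (SameEdge-trans (SameEdge-endpoints x≢y x∈e y∈e) (SameEdge-sym (SameEdge-endpoints x≢y x∈e′ y∈e′)))

at-cong-% : ∀ {n} (Z : CycSeq n) i j → i % len Z ≡ j % len Z → at Z i ≡ at Z j
at-cong-% Z i j e = cong (seq Z) (toℕ-injective (trans (toℕ-fromℕ< _) (trans e (sym (toℕ-fromℕ< _)))))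

at-periodic : ∀ {n} (Z : CycSeq n) i t → at Z (i + t * len Z) ≡ at Z i
at-periodic Z i t = at-cong-% Z (i + t * len Z) i ([m+kn]%n≡m%n i t (len Z))

-- Position q of rev Z is position -1-q of Z, i.e. any X with X + 1 + q ≡ 0 (mod len Z).
at-rev : ∀ {n} (Z : CycSeq n) q X u → X + suc q ≡ u * len Z → at (rev Z) q ≡ at Z X
at-rev Z q X u X+1+q≡uL = cong (seq Z) (toℕ-injective (begin
  toℕ (opposite (q mod L))  ≡⟨ opposite-prop (q mod L) ⟩
  L ∸ suc (toℕ (q mod L))   ≡⟨ cong (λ x → L ∸ suc x) (toℕ-fromℕ< (m%n<n q L)) ⟩
  T                         ≡⟨ m<n⇒m%n≡m T<L ⟨
  T % L                     ≡⟨ %-complement-unique T X (suc q) {suc (q / L)} {u} T+1+q≡L[1+q/L] X+1+q≡uL ⟩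
  X % L                     ≡⟨ toℕ-fromℕ< (m%n<n X L) ⟨
  toℕ (X mod L)             ∎))
  where
  open ≡-Reasoning
  L = len Z
  r = q % L
  T = L ∸ suc r
  T+1+r≡L : T + suc r ≡ L
  T+1+r≡L = m∸n+n≡m (m%n<n q L)
  T<L : T < L
  T<L = subst (T <_) T+1+r≡L (m<m+n T (s≤s z≤n))
  T+1+q≡L[1+q/L] : T + suc q ≡ suc (q / L) * L
  T+1+q≡L[1+q/L] = begin
    T + suc q                    ≡⟨ cong (λ x → T + suc x) (m≡m%n+[m/n]*n q L) ⟩
    T + suc (r + q / L * L)      ≡⟨ +-assoc T (suc r) _ ⟨
    T + suc r + q / L * L        ≡⟨ cong (_+ q / L * L) T+1+r≡L ⟩
    L + q / L * L                ∎

-- Triangles, windows and zigzags of a triangulation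

module Zigzags {n m : ℕ} (Γ : Triangulation n m) where

  open Triangulation Γ

  Distinct₃ : Fin n → Fin n → Fin n → Set
  Distinct₃ x y z = x ≢ y × x ≢ z × y ≢ z

  OnFace : Fin m → Fin n → Fin n → Fin n → Set
  OnFace f x y z = x ∈F f × y ∈F f × z ∈F f

  Triangle : Fin n → Fin n → Fin n → Set
  Triangle x y z = Distinct₃ x y z × ∃[ f ] OnFace f x y z

  face-vertices : ∀ {f x y z w} → Distinct₃ x y z → OnFace f x y z → w ∈F f → w ≡ x ⊎ w ≡ y ⊎ w ≡ z
  face-vertices {f} (x≢y , x≢z , y≢z) ((i , refl) , (j , refl) , (k , refl)) (l , refl) =
    Sum.map (cong (face f)) (Sum.map (cong (face f)) (cong (face f)))
      (Fin3-cover (x≢y ∘ cong (face f)) (x≢z ∘ cong (face f)) (y≢z ∘ cong (face f)) l)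

  third-vertex : ∀ {f y z} → y ∈F f → z ∈F f → ∃[ w ] (w ≢ y × w ≢ z × w ∈F f)
  third-vertex {f} (i , refl) (j , refl) with Fin3-third i j
  ... | k , k≢i , k≢j = face f k , k≢i ∘ face-inj f k i , k≢j ∘ face-inj f k j , k , refl

  face-unique : ∀ {f g x y z} → Distinct₃ x y z → OnFace f x y z → OnFace g x y z → f ≡ g
  face-unique d on-f (x∈g , y∈g , z∈g) = face-distinct _ _ λ w w∈f → in-g (face-vertices d on-f w∈f)
    where
    in-g : ∀ {w} → w ≡ _ ⊎ w ≡ _ ⊎ w ≡ _ → w ∈F _
    in-g (inj₁ refl)        = x∈g
    in-g (inj₂ (inj₁ refl)) = y∈g
    in-g (inj₂ (inj₂ refl)) = z∈g

  Triangle-swap₁₂ : ∀ {x y z} → Triangle x y z → Triangle y x z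
  Triangle-swap₁₂ ((x≢y , x≢z , y≢z) , f , x∈f , y∈f , z∈f) = (≢-sym x≢y , y≢z , x≢z) , f , y∈f , x∈f , z∈f

  Triangle-swap₂₃ : ∀ {x y z} → Triangle x y z → Triangle x z y
  Triangle-swap₂₃ ((x≢y , x≢z , y≢z) , f , x∈f , y∈f , z∈f) = (x≢z , x≢y , ≢-sym y≢z) , f , x∈f , z∈f , y∈f

  Triangle-rotate : ∀ {x y z} → Triangle x y z → Triangle y z x
  Triangle-rotate = Triangle-swap₂₃ ∘ Triangle-swap₁₂

  Triangle⇒Adj : ∀ {x y z} → Triangle x y z → Adj x y
  Triangle⇒Adj ((x≢y , _) , f , x∈f , y∈f , _) = x≢y , f , x∈f , y∈f

  Adj-sym : ∀ {u v} → Adj u v → Adj v u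
  Adj-sym (u≢v , f , u∈f , v∈f) = ≢-sym u≢v , f , v∈f , u∈f

  edge-apexes : ∀ {y z} → Adj y z →
    ∃₂ λ z₁ z₂ → Triangle y z z₁ × Triangle y z z₂ × z₁ ≢ z₂ × (∀ {w} → Triangle y z w → w ≡ z₁ ⊎ w ≡ z₂)
  edge-apexes {y} {z} y∼z@(y≢z , _) with edge-two-faces y z y∼z
  ... | f₁ , f₂ , f₁≢f₂ , (y∈f₁ , z∈f₁) , (y∈f₂ , z∈f₂) , faces-of-yz
    with third-vertex y∈f₁ z∈f₁ | third-vertex y∈f₂ z∈f₂
  ... | z₁ , z₁≢y , z₁≢z , z₁∈f₁ | z₂ , z₂≢y , z₂≢z , z₂∈f₂ =
    z₁ , z₂ , (d₁ , f₁ , y∈f₁ , z∈f₁ , z₁∈f₁) , (d₂ , f₂ , y∈f₂ , z∈f₂ , z₂∈f₂) , z₁≢z₂ , apex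
    where
    d₁ = y≢z , ≢-sym z₁≢y , ≢-sym z₁≢z
    d₂ = y≢z , ≢-sym z₂≢y , ≢-sym z₂≢z
    z₁≢z₂ : z₁ ≢ z₂
    z₁≢z₂ refl = f₁≢f₂ (face-unique d₁ (y∈f₁ , z∈f₁ , z₁∈f₁) (y∈f₂ , z∈f₂ , z₂∈f₂))
    third : ∀ {f w u} → Distinct₃ y z u → OnFace f y z u → w ≢ y → w ≢ z → w ∈F f → w ≡ u
    third d on w≢y w≢z w∈f with face-vertices d on w∈f
    ... | inj₁ w≡y        = ⊥-elim (w≢y w≡y)
    ... | inj₂ (inj₁ w≡z) = ⊥-elim (w≢z w≡z)
    ... | inj₂ (inj₂ w≡u) = w≡u
    apex : ∀ {w} → Triangle y z w → w ≡ z₁ ⊎ w ≡ z₂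
    apex ((_ , y≢w , z≢w) , g , y∈g , z∈g , w∈g) with faces-of-yz g y∈g z∈g
    ... | inj₁ refl = inj₁ (third d₁ (y∈f₁ , z∈f₁ , z₁∈f₁) (≢-sym y≢w) (≢-sym z≢w) w∈g)
    ... | inj₂ refl = inj₂ (third d₂ (y∈f₂ , z∈f₂ , z₂∈f₂) (≢-sym y≢w) (≢-sym z≢w) w∈g)

  apex-unique : ∀ {y z a b c} → Triangle y z a → Triangle y z b → Triangle y z c → a ≢ c → b ≢ c → a ≡ b
  apex-unique t-a t-b t-c with edge-apexes (Triangle⇒Adj t-a)
  ... | _ , _ , _ , _ , _ , apex = ≡-by-two-values (apex t-a) (apex t-b) (apex t-c)

  other-apex : ∀ {x y z} → Triangle x y z → ∃[ w ] (Triangle y z w × w ≢ x)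
  other-apex t with edge-apexes (Triangle⇒Adj (Triangle-rotate t))
  ... | z₁ , z₂ , t₁ , t₂ , z₁≢z₂ , apex with apex (Triangle-rotate t)
  ...   | inj₁ refl = z₂ , t₂ , ≢-sym z₁≢z₂
  ...   | inj₂ refl = z₁ , t₁ , z₁≢z₂

  Triple : Set
  Triple = Fin n × Fin n × Fin n

  _≟ₜ_ : (s t : Triple) → Dec (s ≡ t)
  _≟ₜ_ = ≡-dec _≟_ (≡-dec _≟_ _≟_)

  -- Step moves a window across its second edge into the neighbouring face; Flip moves it across
  -- its first edge, reversing that edge.
  Step : Triple → Triple → Set
  Step (x , y , z) (x′ , y′ , w) = x′ ≡ y × y′ ≡ z × Triangle x y z × Triangle y z w × w ≢ x

  Flip : Triple → Triple → Set
  Flip (x , y , z) (x′ , y′ , w) = x′ ≡ y × y′ ≡ x × Triangle x y z × Triangle y x w × w ≢ z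

  Step-functional : ∀ {s t t′} → Step s t → Step s t′ → t ≡ t′
  Step-functional (refl , refl , t , t-w , w≢x) (refl , refl , _ , t-w′ , w′≢x) =
    cong (λ w → _ , _ , w) (apex-unique t-w t-w′ (Triangle-rotate t) w≢x w′≢x)

  Step-injective : ∀ {s s′ t} → Step s t → Step s′ t → s ≡ s′
  Step-injective (refl , refl , t , t-w , w≢x) (refl , refl , t′ , _ , w≢x′) =
    cong (λ x → x , _ , _) (apex-unique (Triangle-rotate t) (Triangle-rotate t′) t-w (≢-sym w≢x) (≢-sym w≢x′))

  Flip-functional : ∀ {s t t′} → Flip s t → Flip s t′ → t ≡ t′
  Flip-functional (refl , refl , t , t-w , w≢z) (refl , refl , _ , t-w′ , w′≢z) =
    cong (λ w → _ , _ , w) (apex-unique t-w t-w′ (Triangle-swap₁₂ t) w≢z w′≢z)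

  Flip-Step : ∀ {s t s′ t′} → Flip s t → Step s s′ → Step t′ t → Flip s′ t′
  Flip-Step (refl , refl , t-xyz , t-yxz′ , z′≢z) (refl , refl , _ , t-yzw , w≢x) (refl , refl , t-pyx , _ , z′≢p)
    with apex-unique (Triangle-rotate t-pyx) (Triangle-swap₁₂ t-xyz) t-yxz′ (≢-sym z′≢p) (≢-sym z′≢z)
  ... | refl = refl , refl , t-yzw , Triangle-swap₁₂ (Triangle-rotate t-xyz) , ≢-sym w≢x

  Flip-irreflexive : ∀ {s} → ¬ Flip s s
  Flip-irreflexive {_ , _ , _} (x≡y , _ , ((x≢y , _) , _) , _) = x≢y x≡y

  Flip-Step-disjoint : ∀ {s t} → Flip s t → ¬ Step s t
  Flip-Step-disjoint {_ , _ , _} {_ , _ , _} (_ , y′≡x , ((_ , x≢z , _) , _) , _) (_ , y′≡z , _) =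
    x≢z (trans (sym y′≡x) y′≡z)

  ∈E⇒∈F : ∀ {x e f} → x ∈E e → EdgeOf Γ e f → x ∈F f
  ∈E⇒∈F (inj₁ refl) (_ , a∈f , _) = a∈f
  ∈E⇒∈F (inj₂ refl) (_ , _ , b∈f) = b∈f

  joint : Edge n → Edge n → Fin n
  joint (a , b) e with ∈E? a e
  ... | yes _ = a
  ... | no _  = b

  joint-common : ∀ {e e′ f} → TwoEdgesOf Γ e e′ f → CommonVertex (joint e e′) e e′
  joint-common {a , b} {c , d} ((a≢b , a∈f , b∈f) , (c≢d , c∈f , d∈f) , _) with ∈E? a (c , d)
  ... | yes a∈e′ = inj₁ refl , a∈e′
  ... | no a∉e′ with b ≟ c
  ...   | yes b≡c = inj₂ refl , inj₁ b≡c
  ...   | no b≢c with face-vertices (a≢b , a∉e′ ∘ inj₁ , b≢c) (a∈f , b∈f , c∈f) d∈f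
  ...     | inj₁ d≡a        = ⊥-elim (a∉e′ (inj₂ (sym d≡a)))
  ...     | inj₂ (inj₁ d≡b) = inj₂ refl , inj₂ (sym d≡b)
  ...     | inj₂ (inj₂ d≡c) = ⊥-elim (c≢d (sym d≡c))

  ZigzagStep : Edge n → Edge n → Edge n → Set
  ZigzagStep e₁ e₂ e₃ =
    ∃[ f ] ∃[ f′ ] (TwoEdgesOf Γ e₁ e₂ f × TwoEdgesOf Γ e₂ e₃ f′ × f ≢ f′) × (∀ x → ¬ CommonVertex x e₁ e₃)

  Step⇒ZigzagStep : ∀ {x y z w} → Step (x , y , z) (y , z , w) → ZigzagStep (x , y) (y , z) (z , w)
  Step⇒ZigzagStep {x} {y} {z} {w}
    (_ , _ , ((x≢y , x≢z , y≢z) , f , x∈f , y∈f , z∈f) , ((_ , y≢w , z≢w) , f′ , y∈f′ , z∈f′ , w∈f′) , w≢x) =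
    f , f′ ,
    (((x≢y , x∈f , y∈f) , (y≢z , y∈f , z∈f) , xy≠yz) , ((y≢z , y∈f′ , z∈f′) , (z≢w , z∈f′ , w∈f′) , yz≠zw) , f≢f′) ,
    disjoint
    where
    xy≠yz : ¬ SameEdge (x , y) (y , z)
    xy≠yz (inj₁ (x≡y , _)) = x≢y x≡y
    xy≠yz (inj₂ (x≡z , _)) = x≢z x≡z
    yz≠zw : ¬ SameEdge (y , z) (z , w)
    yz≠zw (inj₁ (y≡z , _)) = y≢z y≡z
    yz≠zw (inj₂ (y≡w , _)) = y≢w y≡w
    f≢f′ : f ≢ f′
    f≢f′ refl with face-vertices (x≢y , x≢z , y≢z) (x∈f , y∈f , z∈f) w∈f′
    ... | inj₁ w≡x        = w≢x w≡x
    ... | inj₂ (inj₁ w≡y) = y≢w (sym w≡y)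
    ... | inj₂ (inj₂ w≡z) = z≢w (sym w≡z)
    disjoint : ∀ v → ¬ CommonVertex v (x , y) (z , w)
    disjoint v (inj₁ refl , inj₁ refl) = x≢z refl
    disjoint v (inj₁ refl , inj₂ refl) = w≢x refl
    disjoint v (inj₂ refl , inj₁ refl) = y≢z refl
    disjoint v (inj₂ refl , inj₂ refl) = y≢w refl

  module Turns (Z : CycSeq n) (zigzag : ∀ i → ZigzagAt Γ Z i) where

    turn : ℕ → Fin n
    turn p = joint (at Z p) (at Z (suc p))

    turn-common : ∀ p → CommonVertex (turn p) (at Z p) (at Z (suc p))
    turn-common p with zigzag p
    ... | _ , _ , (two-edges , _) , _ = joint-common two-edges

    turn-unique : ∀ p {x} → CommonVertex x (at Z p) (at Z (suc p)) → x ≡ turn p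
    turn-unique p x-common with zigzag p
    ... | _ , _ , ((_ , _ , e≠e′) , _) , _ = CommonVertex-unique e≠e′ x-common (turn-common p)

    private
      ends-disjoint : ∀ p x → ¬ CommonVertex x (at Z p) (at Z (suc (suc p)))
      ends-disjoint p with zigzag p
      ... | _ , _ , _ , disjoint = disjoint

    turn≢turn₁ : ∀ p → turn p ≢ turn (suc p)
    turn≢turn₁ p e = ends-disjoint p (turn p)
      (proj₁ (turn-common p) , subst (_∈E _) (sym e) (proj₂ (turn-common (suc p))))

    turn≢turn₂ : ∀ p → turn p ≢ turn (suc (suc p))
    turn≢turn₂ p e = turn≢turn₁ p (turn-unique (suc p)
      (proj₂ (turn-common p) , subst (_∈E _) (sym e) (proj₁ (turn-common (suc (suc p))))))

    turn≢turn₃ : ∀ p → turn p ≢ turn (suc (suc (suc p)))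
    turn≢turn₃ p e = ends-disjoint (suc p) (turn p)
      (proj₂ (turn-common p) , subst (_∈E _) (sym e) (proj₁ (turn-common (suc (suc (suc p))))))

    at-suc≈turns : ∀ p → SameEdge (at Z (suc p)) (turn p , turn (suc p))
    at-suc≈turns p = SameEdge-endpoints (turn≢turn₁ p) (proj₂ (turn-common p)) (proj₁ (turn-common (suc p)))

    window : ℕ → Triple
    window p = turn p , turn (suc p) , turn (suc (suc p))

    window-Triangle : ∀ p → Triangle (turn p) (turn (suc p)) (turn (suc (suc p)))
    window-Triangle p with zigzag (suc p)
    ... | f , _ , ((e∈f , e′∈f , _) , _) , _ =
      (turn≢turn₁ p , turn≢turn₂ p , turn≢turn₁ (suc p)) , f ,
      ∈E⇒∈F (proj₂ (turn-common p)) e∈f , ∈E⇒∈F (proj₁ (turn-common (suc p))) e∈f ,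
      ∈E⇒∈F (proj₁ (turn-common (suc (suc p)))) e′∈f

    window-Step : ∀ p → Step (window p) (window (suc p))
    window-Step p = refl , refl , window-Triangle p , window-Triangle (suc p) , ≢-sym (turn≢turn₃ p)

    turn-periodic : ∀ p t → turn (p + t * len Z) ≡ turn p
    turn-periodic p t = cong₂ joint (at-periodic Z p t) (at-periodic Z (suc p) t)

    window-periodic : ∀ p t → window (p + t * len Z) ≡ window p
    window-periodic p t =
      cong₂ _,_ (turn-periodic p t) (cong₂ _,_ (turn-periodic (suc p) t) (turn-periodic (suc (suc p)) t))

    window-representative : ∀ p → ∃[ i ] window (k Z + toℕ i) ≡ window p
    window-representative p = suc p mod L , (begin
        window (k Z + toℕ (suc p mod L))   ≡⟨ cong (λ x → window (k Z + x)) (toℕ-fromℕ< (m%n<n (suc p) L)) ⟩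
        window (k Z + ρ)                   ≡⟨ window-periodic (k Z + ρ) t ⟨
        window (k Z + ρ + t * L)           ≡⟨ cong window (+-assoc (k Z) ρ _) ⟩
        window (k Z + (ρ + t * L))         ≡⟨ cong (λ x → window (k Z + x)) (m≡m%n+[m/n]*n (suc p) L) ⟨
        window (k Z + suc p)               ≡⟨ cong window (wrap (k Z) p) ⟩
        window (p + 1 * L)                 ≡⟨ window-periodic p 1 ⟩
        window p                           ∎)
      where
      open ≡-Reasoning
      L = len Z
      ρ = suc p % L
      t = suc p / L
      wrap : ∀ k p → k + suc p ≡ p + 1 * suc k
      wrap = solve-∀

  module Comparison (Z : CycSeq n) (zZ : ∀ i → ZigzagAt Γ Z i) (Z′ : CycSeq n) (zZ′ : ∀ i → ZigzagAt Γ Z′ i) where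
    module A = Turns Z zZ
    module B = Turns Z′ zZ′

    windows-agree : ∀ {p p′} → A.window p ≡ B.window p′ → ∀ d → A.window (d + p) ≡ B.window (d + p′)
    windows-agree e zero    = e
    windows-agree e (suc d) = Step-functional (A.window-Step (d + _))
      (subst (λ s → Step s (B.window (suc d + _))) (sym (windows-agree e d)) (B.window-Step (d + _)))

    window≡⇒rotated : ∀ {p p′} → A.window p ≡ B.window p′ →
                      ∀ q → SameEdge (at Z (q + (suc p + k Z′ * suc p′))) (at Z′ q)
    window≡⇒rotated {p} {p′} e q = subst₂ SameEdge
        (cong (at Z) (shift-A q p (k Z′ * suc p′)))
        (trans (cong (at Z′) (shift-B q p′ (k Z′))) (at-periodic Z′ q (suc p′)))
        (SameEdge-trans (A.at-suc≈turns (d + p))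
          (SameEdge-trans (inj₁ (cong proj₁ agree , cong (proj₁ ∘ proj₂) agree))
            (SameEdge-sym (B.at-suc≈turns (d + p′)))))
      where
      d = q + k Z′ * suc p′
      agree = windows-agree e d
      shift-A : ∀ q p c → suc (q + c + p) ≡ q + (suc p + c)
      shift-A = solve-∀
      shift-B : ∀ q p k → suc (q + k * suc p + p) ≡ q + suc p * suc k
      shift-B = solve-∀

    window≡⇒≈Z : ∀ {p p′} → A.window p ≡ B.window p′ → Z ≈Z Z′
    window≡⇒≈Z e = _ , window≡⇒rotated e

    flip-forward : ∀ {a} b d → Flip (A.window a) (B.window (d + b)) → Flip (A.window (d + a)) (B.window b)
    flip-forward b zero    fl = fl
    flip-forward {a} b (suc d) fl = subst (λ x → Flip (A.window x) (B.window b)) (+-suc d a)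
      (flip-forward {suc a} b d (Flip-Step fl (A.window-Step a) (B.window-Step (d + b))))

    flip-edges : ∀ {x y} → Flip (A.window x) (B.window y) → SameEdge (at Z (suc x)) (at Z′ (suc y))
    flip-edges {x} {y} (y≡x₁ , y₁≡x , _) = SameEdge-trans (A.at-suc≈turns x)
      (SameEdge-trans (inj₂ (sym y₁≡x , sym y≡x₁)) (SameEdge-sym (B.at-suc≈turns y)))

    Flip⇒≈Z-rev : ∀ {a b} → Flip (A.window a) (B.window b) → Z ≈Z rev Z′
    Flip⇒≈Z-rev {a} {b} fl = suc a + (b + 2) , λ q → subst₂ SameEdge
        (cong (at Z) (shift-A q a b)) (sym (at-rev Z′ q (suc (W q)) (q + 2) (shift-rev (k Z′) q)))
        (flip-edges (flip-forward (W q) (q + (b + 2))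
          (subst (Flip (A.window a)) (trans (sym (B.window-periodic b (q + 2))) (cong B.window (sym (shift-B q b (k Z′)))))
            fl)))
      where
      W : ℕ → ℕ
      W q = k Z′ * (q + 2)
      shift-A : ∀ q a b → suc (q + (b + 2) + a) ≡ q + (suc a + (b + 2))
      shift-A = solve-∀
      shift-B : ∀ q b k → q + (b + 2) + k * (q + 2) ≡ b + (q + 2) * suc k
      shift-B = solve-∀
      shift-rev : ∀ k q → suc (k * (q + 2)) + suc q ≡ (q + 2) * suc k
      shift-rev = solve-∀

    turn-aligned : ∀ {P Q} → SameEdge (at Z P) (at Z′ Q) → SameEdge (at Z (suc P)) (at Z′ (suc Q)) →
                   A.turn P ≡ B.turn Q
    turn-aligned {P} {Q} e e₁ = B.turn-unique Q
      (∈E-resp-SameEdge e (proj₁ (A.turn-common P)) , ∈E-resp-SameEdge e₁ (proj₂ (A.turn-common P)))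

    turn-mirrored : ∀ {P Q} → SameEdge (at Z P) (at Z′ (suc Q)) → SameEdge (at Z (suc P)) (at Z′ Q) →
                    A.turn P ≡ B.turn Q
    turn-mirrored {P} {Q} e e₁ = B.turn-unique Q
      (∈E-resp-SameEdge e₁ (proj₂ (A.turn-common P)) , ∈E-resp-SameEdge e (proj₁ (A.turn-common P)))

    rotated⇒window≡ : ∀ {r} → (∀ q → SameEdge (at Z (q + r)) (at Z′ q)) → ∀ q → A.window (q + r) ≡ B.window q
    rotated⇒window≡ rot q = cong₂ _,_ (aligned q) (cong₂ _,_ (aligned (suc q)) (aligned (suc (suc q))))
      where aligned = λ q → turn-aligned (rot q) (rot (suc q))

    rotated-rev⇒Flip : ∀ {r} → (∀ q → SameEdge (at Z (q + r)) (at (rev Z′) q)) →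
                       ∀ q → Flip (A.window (q + r)) (B.window (suc (k Z′ * (q + 4))))
    rotated-rev⇒Flip {r} rot q =
      subst₂ (λ x y → Flip (A.window (q + r)) (x , y , B.turn (3 + W))) t₁ t₀
        (refl , refl , A.window-Triangle (q + r) ,
         subst₂ (λ x y → Triangle x y (B.turn (3 + W))) (sym t₁) (sym t₀) (B.window-Triangle (1 + W)) ,
         λ e → B.turn≢turn₃ W (sym (trans e t₂)))
      where
      W = k Z′ * (q + 4)
      -- Reversal pairs the edges of Z at q + r, …, 3 + q + r with those of Z′ at 3 + W, …, W.
      mirror : ∀ d e → d + e ≡ 3 → SameEdge (at Z (d + q + r)) (at Z′ (e + W))
      mirror d e d+e≡3 = subst (SameEdge _) (at-rev Z′ (d + q) (e + W) (q + 4) (begin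
          e + W + suc (d + q)   ≡⟨ regroup e W d q ⟩
          W + suc (d + e + q)   ≡⟨ cong (λ x → W + suc (x + q)) d+e≡3 ⟩
          W + suc (3 + q)       ≡⟨ wrap (k Z′) q ⟩
          (q + 4) * len Z′      ∎)) (rot (d + q))
        where
        open ≡-Reasoning
        regroup : ∀ e W d q → e + W + suc (d + q) ≡ W + suc (d + e + q)
        regroup = solve-∀
        wrap : ∀ k q → k * (q + 4) + suc (3 + q) ≡ (q + 4) * suc k
        wrap = solve-∀
      t₀ : A.turn (q + r) ≡ B.turn (2 + W)
      t₀ = turn-mirrored (mirror 0 3 refl) (mirror 1 2 refl)
      t₁ : A.turn (1 + q + r) ≡ B.turn (1 + W)
      t₁ = turn-mirrored (mirror 1 2 refl) (mirror 2 1 refl)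
      t₂ : A.turn (2 + q + r) ≡ B.turn W
      t₂ = turn-mirrored (mirror 2 1 refl) (mirror 3 0 refl)

  module SelfComparison (Z : CycSeq n) (zZ : ∀ i → ZigzagAt Γ Z i)
    (minimal : ∀ p → 0 < p → p < len Z → ¬ (∀ i → SameEdge (at Z (i + p)) (at Z i))) where
    open Comparison Z zZ Z zZ

    flip-meets : ∀ a b h Y → b + a * len Z ≡ h + Y → Flip (A.window a) (A.window b) →
                 Flip (A.window (a + h)) (A.window Y)
    flip-meets a b h Y e fl = subst (λ x → Flip (A.window x) (A.window Y)) (+-comm h a)
      (flip-forward Y h (subst (Flip (A.window a)) (trans (sym (A.window-periodic b a)) (cong A.window e)) fl))

    private
      unfold : ∀ a b k → b + a * suc k ≡ a + (b + a * k)
      unfold = solve-∀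
      meet-even : ∀ a h → a + (h + h) ≡ h + (a + h)
      meet-even = solve-∀
      meet-odd : ∀ a h → a + suc (h + h) ≡ h + suc (a + h)
      meet-odd = solve-∀

    -- Walking forward from a and backward from b, the two windows meet after half the distance.
    no-self-flip : ∀ a b → ¬ Flip (A.window a) (A.window b)
    no-self-flip a b fl with even-or-odd (b + a * k Z)
    ... | h , inj₁ even = Flip-irreflexive
            (flip-meets a b h (a + h) (trans (unfold a b (k Z)) (trans (cong (a +_) even) (meet-even a h))) fl)
    ... | h , inj₂ odd  = Flip-Step-disjoint
            (flip-meets a b h (suc (a + h)) (trans (unfold a b (k Z)) (trans (cong (a +_) odd) (meet-odd a h))) fl)
            (A.window-Step (a + h))

    window-period : ∀ c d → 0 < d → d < len Z → A.window c ≢ A.window (c + d)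
    window-period c d 0<d d<L e = minimal d 0<d d<L λ q →
      subst (λ x → SameEdge x (at Z q)) (trans (cong (at Z) (shift q c d (k Z))) (at-periodic Z (q + d) (suc c)))
        (window≡⇒rotated (sym e) q)
      where
      shift : ∀ q c d k → q + (suc (c + d) + k * suc c) ≡ q + d + suc c * suc k
      shift = solve-∀

    window-injective-< : ∀ (i j : Fin (len Z)) → toℕ i < toℕ j → A.window (k Z + toℕ i) ≢ A.window (k Z + toℕ j)
    window-injective-< i j i<j e = window-period (k Z + toℕ i) (toℕ j ∸ toℕ i) (m<n⇒0<n∸m i<j)
      (≤-<-trans (m∸n≤m (toℕ j) (toℕ i)) (toℕ<n j))
      (trans e (cong A.window (trans (cong (k Z +_) (sym (m+[n∸m]≡n (<⇒≤ i<j)))) (sym (+-assoc (k Z) (toℕ i) _)))))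

    window-injective : ∀ (i j : Fin (len Z)) → A.window (k Z + toℕ i) ≡ A.window (k Z + toℕ j) → i ≡ j
    window-injective i j e with <-cmp (toℕ i) (toℕ j)
    ... | tri< i<j _ _ = ⊥-elim (window-injective-< i j i<j e)
    ... | tri≈ _ i≡j _ = toℕ-injective i≡j
    ... | tri> _ _ j<i = ⊥-elim (window-injective-< j i j<i (sym e))

  -- Every oriented triangle is a window of a zigzag

  IsTriangle : Triple → Set
  IsTriangle (x , y , z) = Triangle x y z

  OrientedTriangle : Set
  OrientedTriangle = Σ Triple IsTriangle

  advance : OrientedTriangle → OrientedTriangle
  advance ((x , y , z) , t) = (y , z , proj₁ (other-apex t)) , proj₁ (proj₂ (other-apex t))

  advance-Step : ∀ s → Step (proj₁ s) (proj₁ (advance s))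
  advance-Step ((x , y , z) , t) = refl , refl , t , proj₂ (other-apex t)

  encode : Triple → Fin (n * (n * n))
  encode (x , y , z) = combine x (combine y z)

  encode-injective : ∀ s t → encode s ≡ encode t → s ≡ t
  encode-injective (x , y , z) (x′ , y′ , z′) e with combine-injective x _ x′ _ e
  ... | refl , e′ with combine-injective y z y′ z′ e′
  ...   | refl , refl = refl

  module Orbit (s : OrientedTriangle) where

    orbit : ℕ → Triple
    orbit i = proj₁ (fold s advance i)

    orbit-Step : ∀ i → Step (orbit i) (orbit (suc i))
    orbit-Step i = advance-Step (fold s advance i)

    orbit-cancel : ∀ i j → orbit (suc i) ≡ orbit (suc j) → orbit i ≡ orbit j
    orbit-cancel i j e = Step-injective (orbit-Step i) (subst (Step (orbit j)) (sym e) (orbit-Step j))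

    orbit-shift : ∀ i j → orbit i ≡ orbit j → orbit (suc i) ≡ orbit (suc j)
    orbit-shift i j e = Step-functional (orbit-Step i) (subst (λ t → Step t (orbit (suc j))) (sym e) (orbit-Step j))

    orbit-recurrence : ∀ a d → orbit a ≡ orbit (a + d) → orbit 0 ≡ orbit d
    orbit-recurrence zero    d e = e
    orbit-recurrence (suc a) d e = orbit-recurrence a d (orbit-cancel a (a + d) e)

    returns-after : ∀ {a b} → a < b → orbit a ≡ orbit b → ∃[ d ] orbit (suc d) ≡ orbit 0
    returns-after {a} {b} a<b e
      with b ∸ a | m<n⇒0<n∸m a<b | orbit-recurrence a (b ∸ a) (trans e (cong orbit (sym (m+[n∸m]≡n (<⇒≤ a<b)))))
    ... | suc d | _ | e′ = d , sym e′

    opaque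
      orbit-returns : ∃[ d ] orbit (suc d) ≡ orbit 0
      orbit-returns with pigeonhole (n<1+n (n * (n * n))) (encode ∘ orbit ∘ toℕ)
      ... | i , j , i<j , e = returns-after i<j (encode-injective _ _ e)

    least-return : ∃[ l ] (orbit (suc l) ≡ orbit 0 × ∀ d → d < l → orbit (suc d) ≢ orbit 0)
    least-return = uncurry (least-witness (λ d → orbit (suc d) ≟ₜ orbit 0)) orbit-returns

    period : ℕ
    period = proj₁ least-return

    returns : orbit (suc period) ≡ orbit 0
    returns = proj₁ (proj₂ least-return)

    no-earlier-return : ∀ d → d < period → orbit (suc d) ≢ orbit 0
    no-earlier-return = proj₂ (proj₂ least-return)

    orbit-periodic : ∀ p t → orbit (p + t * suc period) ≡ orbit p
    orbit-periodic p zero    = cong orbit (+-identityʳ p)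
    orbit-periodic p (suc t) = begin
      orbit (p + (suc period + t * suc period))  ≡⟨ cong orbit (regroup p (suc period) (t * suc period)) ⟩
      orbit (p + t * suc period + suc period)    ≡⟨ one-period (p + t * suc period) ⟩
      orbit (p + t * suc period)                 ≡⟨ orbit-periodic p t ⟩
      orbit p                                    ∎
      where
      open ≡-Reasoning
      regroup : ∀ a b c → a + (b + c) ≡ a + c + b
      regroup = solve-∀
      one-period : ∀ p → orbit (p + suc period) ≡ orbit p
      one-period zero    = returns
      one-period (suc p) = orbit-shift (p + suc period) p (one-period p)

    leading-edge : Triple → Edge n
    leading-edge (x , y , _) = x , y

    Zigzag : CycSeq n
    Zigzag = cyc period (leading-edge ∘ orbit ∘ toℕ)

    at-Zigzag : ∀ p → at Zigzag p ≡ leading-edge (orbit p)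
    at-Zigzag p = cong leading-edge (begin
      orbit (toℕ (p mod L))      ≡⟨ cong orbit (toℕ-fromℕ< (m%n<n p L)) ⟩
      orbit (p % L)              ≡⟨ orbit-periodic (p % L) (p / L) ⟨
      orbit (p % L + p / L * L)  ≡⟨ cong orbit (m≡m%n+[m/n]*n p L) ⟨
      orbit p                    ∎)
      where
      open ≡-Reasoning
      L = suc period

    Zigzag-conditions : ∀ i → ZigzagAt Γ Zigzag i
    Zigzag-conditions i = resp (at-Zigzag i) (at-Zigzag (suc i)) (at-Zigzag (suc (suc i))) (Step⇒ZigzagStep (orbit-Step i))
      where
      resp : ∀ {e₁ e₂ e₃ e₁′ e₂′ e₃′} → e₁ ≡ e₁′ → e₂ ≡ e₂′ → e₃ ≡ e₃′ →
             ZigzagStep e₁′ e₂′ e₃′ → ZigzagStep e₁ e₂ e₃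
      resp refl refl refl z = z

    module T = Turns Zigzag Zigzag-conditions

    turn≡middle : ∀ q → T.turn q ≡ proj₁ (proj₂ (orbit q))
    turn≡middle q = sym (T.turn-unique q
      (subst (y ∈E_) (sym (at-Zigzag q)) (inj₂ refl) , subst (y ∈E_) (sym (at-Zigzag (suc q))) (inj₁ refl)))
      where y = proj₁ (proj₂ (orbit q))

    window≡orbit : ∀ q → T.window q ≡ orbit (suc q)
    window≡orbit q = cong₂ _,_ (turn≡middle q) (cong₂ _,_ (turn≡middle (suc q)) (turn≡middle (suc (suc q))))

    Zigzag-minimal : ∀ p → 0 < p → p < len Zigzag → ¬ (∀ i → SameEdge (at Zigzag (i + p)) (at Zigzag i))
    Zigzag-minimal (suc p) _ (s≤s p<period) shifted = no-earlier-return p p<period (begin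
      orbit (suc p)                       ≡⟨ orbit-periodic (suc p) 1 ⟨
      orbit (suc p + 1 * suc period)      ≡⟨ cong orbit (wrap p period) ⟩
      orbit (suc (period + suc p))        ≡⟨ window≡orbit (period + suc p) ⟨
      T.window (period + suc p)           ≡⟨ C.rotated⇒window≡ shifted period ⟩
      T.window period                     ≡⟨ window≡orbit period ⟩
      orbit (suc period)                  ≡⟨ returns ⟩
      orbit 0                             ∎)
      where
      open ≡-Reasoning
      module C = Comparison Zigzag Zigzag-conditions Zigzag Zigzag-conditions
      wrap : ∀ p l → suc p + 1 * suc l ≡ suc (l + suc p)
      wrap = solve-∀

  ZigzagThrough : Triple → Set
  ZigzagThrough s = Σ (CycSeq n) λ Z → Σ (IsZigzag Γ Z) λ z → ∃[ p ] Turns.window Z (proj₁ z) p ≡ s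

  zigzag-through : ∀ (s : OrientedTriangle) → ZigzagThrough (proj₁ s)
  zigzag-through s = Zigzag , (Zigzag-conditions , Zigzag-minimal) , period , trans (window≡orbit period) returns
    where open Orbit s

-- Counting traversals in a z-orientation

module ZOrientation {n m : ℕ} (Γ : Triangulation n m) {K : ℕ} (τ : Fin K → CycSeq n) (oz : IsZOrientation Γ τ) where

  open Zigzags Γ
  open Triangulation Γ using (Adj)

  zigzag-of : ∀ j i → ZigzagAt Γ (τ j) i
  zigzag-of j = proj₁ (proj₁ oz j)

  module Zig (j : Fin K) = Turns (τ j) (zigzag-of j)

  turn : Fin K → ℕ → Fin n
  turn j = Zig.turn j

  -- TraversesAt (τ j) i reads the edges at len + i ∸ 1 = k + i and its successor, whose common
  -- vertex is the turn at k + i.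
  position : ∀ j → Fin (len (τ j)) → ℕ
  position j i = k (τ j) + toℕ i

  traversal : ∀ j → Fin (len (τ j)) → Fin n → Fin n → ℕ
  traversal j i u v = 𝟙 (turn j (position j i) ≟ u) * 𝟙 (turn j (suc (position j i)) ≟ v)

  𝟙-traverses : ∀ j i u v → 𝟙 (TraversesAt? (τ j) i u v) ≡ traversal j i u v
  𝟙-traverses j i u v = trans
    (𝟙-cong (TraversesAt? (τ j) i u v) ((turn j p ≟ u) ×-dec (turn j (suc p) ≟ v))
      (λ (u-common , v-common) → sym (Zig.turn-unique j p u-common) , sym (Zig.turn-unique j (suc p) v-common))
      (λ { (refl , refl) → Zig.turn-common j p , Zig.turn-common j (suc p) }))
    (𝟙-× (turn j p ≟ u) (turn j (suc p) ≟ v))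
    where p = position j i

  Occ≡sum : ∀ u v → Occ τ u v ≡ ∑[ j < K ] ∑[ i < len (τ j) ] traversal j i u v
  Occ≡sum u v = begin
    Occ τ u v
      ≡⟨ sumFin≡sum (λ j → count (λ i → TraversesAt? (τ j) i u v)) ⟩
    ∑[ j < K ] count (λ i → TraversesAt? (τ j) i u v)
      ≡⟨ sum-cong-≗ (λ j → count≡sum (λ i → TraversesAt? (τ j) i u v)) ⟩
    ∑[ j < K ] ∑[ i < len (τ j) ] 𝟙 (TraversesAt? (τ j) i u v)
      ≡⟨ sum-cong-≗ (λ j → sum-cong-≗ (λ i → 𝟙-traverses j i u v)) ⟩
    ∑[ j < K ] ∑[ i < len (τ j) ] traversal j i u v ∎
    where open ≡-Reasoning

  Occ-nonadjacent : ∀ {u v} → ¬ Adj u v → Occ τ u v ≡ 0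
  Occ-nonadjacent {u} {v} ¬adj = trans (Occ≡sum u v)
    (sum-zero (λ j → ∑[ i < len (τ j) ] traversal j i u v) λ j → sum-zero (λ i → traversal j i u v) λ i →
      trans (sym (𝟙-× (turn j (position j i) ≟ u) (turn j (suc (position j i)) ≟ v)))
            (𝟙-no _ λ { (refl , refl) → ¬adj (Triangle⇒Adj (Zig.window-Triangle j (position j i))) }))

  sum-traversal-sources : ∀ j i v → ∑[ u < n ] traversal j i u v ≡ 𝟙 (turn j (suc (position j i)) ≟ v)
  sum-traversal-sources j i v = sum-δ (turn j (position j i)) (𝟙 (turn j (suc (position j i)) ≟ v))

  sum-traversal-targets : ∀ j i v → ∑[ w < n ] traversal j i v w ≡ 𝟙 (turn j (position j i) ≟ v)
  sum-traversal-targets j i v = trans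
    (sum-cong-≗ (λ w → *-comm (𝟙 (turn j (position j i) ≟ v)) (𝟙 (turn j (suc (position j i)) ≟ w))))
    (sum-δ (turn j (suc (position j i))) (𝟙 (turn j (position j i) ≟ v)))

  entries : Fin n → Fin K → ℕ
  entries v j = ∑[ i < len (τ j) ] 𝟙 (turn j (suc (position j i)) ≟ v)

  exits : Fin n → Fin K → ℕ
  exits v j = ∑[ i < len (τ j) ] 𝟙 (turn j (position j i) ≟ v)

  ∑Occ-into : ∀ v → ∑[ u < n ] Occ τ u v ≡ ∑[ j < K ] entries v j
  ∑Occ-into v = begin
    ∑[ u < n ] Occ τ u v
      ≡⟨ sum-cong-≗ (λ u → Occ≡sum u v) ⟩
    ∑[ u < n ] ∑[ j < K ] ∑[ i < len (τ j) ] traversal j i u v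
      ≡⟨ ∑-comm (λ u j → ∑[ i < len (τ j) ] traversal j i u v) ⟩
    ∑[ j < K ] ∑[ u < n ] ∑[ i < len (τ j) ] traversal j i u v
      ≡⟨ sum-cong-≗ (λ j → ∑-comm (λ u i → traversal j i u v)) ⟩
    ∑[ j < K ] ∑[ i < len (τ j) ] ∑[ u < n ] traversal j i u v
      ≡⟨ sum-cong-≗ (λ j → sum-cong-≗ (λ i → sum-traversal-sources j i v)) ⟩
    ∑[ j < K ] entries v j ∎
    where open ≡-Reasoning

  ∑Occ-out-of : ∀ v → ∑[ w < n ] Occ τ v w ≡ ∑[ j < K ] exits v j
  ∑Occ-out-of v = begin
    ∑[ w < n ] Occ τ v w
      ≡⟨ sum-cong-≗ (λ w → Occ≡sum v w) ⟩
    ∑[ w < n ] ∑[ j < K ] ∑[ i < len (τ j) ] traversal j i v w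
      ≡⟨ ∑-comm (λ w j → ∑[ i < len (τ j) ] traversal j i v w) ⟩
    ∑[ j < K ] ∑[ w < n ] ∑[ i < len (τ j) ] traversal j i v w
      ≡⟨ sum-cong-≗ (λ j → ∑-comm (λ w i → traversal j i v w)) ⟩
    ∑[ j < K ] ∑[ i < len (τ j) ] ∑[ w < n ] traversal j i v w
      ≡⟨ sum-cong-≗ (λ j → sum-cong-≗ (λ i → sum-traversal-targets j i v)) ⟩
    ∑[ j < K ] exits v j ∎
    where open ≡-Reasoning

  entries≡exits : ∀ v j → entries v j ≡ exits v j
  entries≡exits v j = trans
    (sum-cong-≗ {len (τ j)} (λ i → cong (λ x → 𝟙 (turn j x ≟ v)) (sym (+-suc (k (τ j)) (toℕ i)))))
    (sum-rotate (len (τ j)) g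
      (cong (λ x → 𝟙 (x ≟ v)) (trans (cong (turn j) (wrap (k (τ j)))) (Zig.turn-periodic j (k (τ j) + 0) 1))))
    where
    g : ℕ → ℕ
    g x = 𝟙 (turn j (k (τ j) + x) ≟ v)
    wrap : ∀ k → k + suc k ≡ k + 0 + 1 * suc k
    wrap = solve-∀

  flow-conservation : ∀ v → ∑[ u < n ] Occ τ u v ≡ ∑[ w < n ] Occ τ v w
  flow-conservation v = trans (∑Occ-into v) (trans (sum-cong-≗ (entries≡exits v)) (sym (∑Occ-out-of v)))

  minimal-of : ∀ j p → 0 < p → p < len (τ j) → ¬ (∀ i → SameEdge (at (τ j) (i + p)) (at (τ j) i))
  minimal-of j = proj₂ (proj₁ oz j)

  window : ∀ j → Fin (len (τ j)) → Triple
  window j i = Zig.window j (position j i)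

  module FlipPair {s s′ : Triple} (flip : Flip s s′) where

    Visits : ∀ j → Fin (len (τ j)) → Set
    Visits j i = window j i ≡ s ⊎ window j i ≡ s′

    visits? : ∀ j i → Dec (Visits j i)
    visits? j i = (window j i ≟ₜ s) ⊎-dec (window j i ≟ₜ s′)

    private
      module _ (Z : CycSeq n) (zZ : ∀ i → ZigzagAt Γ Z i) {p : ℕ} (window≡s : Turns.window Z zZ p ≡ s)
               (j : Fin K) {r : ℕ} where
        module ZT = Comparison Z zZ (τ j) (zigzag-of j)

        q : ℕ
        q = p + r * k Z

        back-to-s : ZT.A.window (q + r) ≡ s
        back-to-s = trans (cong ZT.A.window (shift p r (k Z))) (trans (ZT.A.window-periodic p r) window≡s)
          where
          shift : ∀ p r k → p + r * k + r ≡ p + r * suc k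
          shift = solve-∀

        aligned-visit : (∀ q → SameEdge (at Z (q + r)) (at (τ j) q)) → ∃[ i ] Visits j i
        aligned-visit rot = i , inj₁ (trans i≡q (trans (sym (ZT.rotated⇒window≡ rot q)) back-to-s))
          where
          i = proj₁ (Zig.window-representative j q)
          i≡q = proj₂ (Zig.window-representative j q)

        reversed-visit : (∀ q → SameEdge (at Z (q + r)) (at (rev (τ j)) q)) → ∃[ i ] Visits j i
        reversed-visit rot = i , inj₂ (trans i≡W (sym (Flip-functional flip
            (subst (λ t → Flip t (ZT.B.window W)) back-to-s (ZT.rotated-rev⇒Flip rot q)))))
          where
          W = suc (k (τ j) * (q + 4))
          i = proj₁ (Zig.window-representative j W)
          i≡W = proj₂ (Zig.window-representative j W)

    visit : ZigzagThrough s → ∃[ j ] ∃[ i ] Visits j i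
    visit (Z , isZ@(zZ , _) , _ , window≡s) with proj₂ (proj₂ oz) Z isZ
    ... | j , inj₁ (_ , rot) = j , aligned-visit Z zZ window≡s j rot
    ... | j , inj₂ (_ , rot) = j , reversed-visit Z zZ window≡s j rot

    visited : ∃[ j ] ∃[ i ] Visits j i
    visited = visit (zigzag-through (s , proj₁ (proj₂ (proj₂ flip))))

    visits-one-zigzag : ∀ {j j′ i i′} → Visits j i → Visits j′ i′ → j ≡ j′
    visits-one-zigzag {j} {j′} {i} {i′} v v′ = decidable-stable (j ≟ j′) λ j≢j′ →
      separated (proj₁ (proj₂ oz) j j′ j≢j′) (proj₁ (proj₂ oz) j′ j (≢-sym j≢j′)) v v′
      where
      module T  = Comparison (τ j) (zigzag-of j) (τ j′) (zigzag-of j′)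
      module T′ = Comparison (τ j′) (zigzag-of j′) (τ j) (zigzag-of j)
      separated : ¬ (τ j ≈Z τ j′) × ¬ (τ j ≈Z rev (τ j′)) → ¬ (τ j′ ≈Z τ j) × ¬ (τ j′ ≈Z rev (τ j)) →
                  Visits j i → Visits j′ i′ → ⊥
      separated (≉ , _)  _        (inj₁ a) (inj₁ b) = ≉ (T.window≡⇒≈Z (trans a (sym b)))
      separated (≉ , _)  _        (inj₂ a) (inj₂ b) = ≉ (T.window≡⇒≈Z (trans a (sym b)))
      separated (_ , ≉ʳ) _        (inj₁ a) (inj₂ b) = ≉ʳ (T.Flip⇒≈Z-rev (subst₂ Flip (sym a) (sym b) flip))
      separated _        (_ , ≉ʳ) (inj₂ a) (inj₁ b) = ≉ʳ (T′.Flip⇒≈Z-rev (subst₂ Flip (sym b) (sym a) flip))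

    visits-one-position : ∀ {j i i′} → Visits j i → Visits j i′ → i ≡ i′
    visits-one-position {j} {i} {i′} = same-position
      where
      module S = SelfComparison (τ j) (zigzag-of j) (minimal-of j)
      same-position : Visits j i → Visits j i′ → i ≡ i′
      same-position (inj₁ a) (inj₁ b) = S.window-injective i i′ (trans a (sym b))
      same-position (inj₂ a) (inj₂ b) = S.window-injective i i′ (trans a (sym b))
      same-position (inj₁ a) (inj₂ b) = ⊥-elim (S.no-self-flip _ _ (subst₂ Flip (sym a) (sym b) flip))
      same-position (inj₂ a) (inj₁ b) = ⊥-elim (S.no-self-flip _ _ (subst₂ Flip (sym b) (sym a) flip))

    visited-once : ∑[ j < K ] ∑[ i < len (τ j) ] 𝟙 (visits? j i) ≡ 1
    visited-once = once visited
      where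
      once : ∃[ j ] ∃[ i ] Visits j i → ∑[ j < K ] ∑[ i < len (τ j) ] 𝟙 (visits? j i) ≡ 1
      once (j , i , v) = trans
        (sum-single (λ j → ∑[ i < len (τ j) ] 𝟙 (visits? j i)) j λ j′ j′≢j →
          sum-zero (λ i → 𝟙 (visits? j′ i)) λ i′ → 𝟙-no (visits? j′ i′) λ v′ → j′≢j (visits-one-zigzag v′ v))
        (sum-𝟙-unique (visits? j) i v λ i′ v′ → visits-one-position v′ v)

  apex-split : ∀ {u v z₁ z₂ a b c} → z₁ ≢ z₂ → (∀ {w} → Triangle u v w → w ≡ z₁ ⊎ w ≡ z₂) → Triangle a b c →
    𝟙 ((a ≟ u) ×-dec (b ≟ v)) ≡ 𝟙 ((a , b , c) ≟ₜ (u , v , z₁)) + 𝟙 ((a , b , c) ≟ₜ (u , v , z₂))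
  apex-split {u} {v} {z₁} {z₂} {a} {b} {c} z₁≢z₂ apex t = trans
    (𝟙-cong ((a ≟ u) ×-dec (b ≟ v)) (((a , b , c) ≟ₜ (u , v , z₁)) ⊎-dec ((a , b , c) ≟ₜ (u , v , z₂))) to from)
    (𝟙-⊎ ((a , b , c) ≟ₜ (u , v , z₁)) ((a , b , c) ≟ₜ (u , v , z₂))
      λ (e₁ , e₂) → z₁≢z₂ (cong (proj₂ ∘ proj₂) (trans (sym e₁) e₂)))
    where
    to : a ≡ u × b ≡ v → (a , b , c) ≡ (u , v , z₁) ⊎ (a , b , c) ≡ (u , v , z₂)
    to (refl , refl) = Sum.map (cong (λ w → a , b , w)) (cong (λ w → a , b , w)) (apex t)
    from : (a , b , c) ≡ (u , v , z₁) ⊎ (a , b , c) ≡ (u , v , z₂) → a ≡ u × b ≡ v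
    from (inj₁ refl) = refl , refl
    from (inj₂ refl) = refl , refl

  traversals-split : ∀ j i {u v z₁ z₂} → u ≢ v → z₁ ≢ z₂ → (∀ {w} → Triangle u v w → w ≡ z₁ ⊎ w ≡ z₂) →
    traversal j i u v + traversal j i v u ≡
    𝟙 ((window j i ≟ₜ (u , v , z₁)) ⊎-dec (window j i ≟ₜ (v , u , z₂))) +
    𝟙 ((window j i ≟ₜ (u , v , z₂)) ⊎-dec (window j i ≟ₜ (v , u , z₁)))
  traversals-split j i {u} {v} {z₁} {z₂} u≢v z₁≢z₂ apex = begin
    traversal j i u v + traversal j i v u
      ≡⟨ cong₂ _+_ (sym (𝟙-× (a ≟ u) (b ≟ v))) (sym (𝟙-× (a ≟ v) (b ≟ u))) ⟩
    𝟙 ((a ≟ u) ×-dec (b ≟ v)) + 𝟙 ((a ≟ v) ×-dec (b ≟ u))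
      ≡⟨ cong₂ _+_ (apex-split z₁≢z₂ apex t) (apex-split (≢-sym z₁≢z₂) (Sum.swap ∘ apex ∘ Triangle-swap₁₂) t) ⟩
    (𝟙 (w ≟ₜ s₁) + 𝟙 (w ≟ₜ s₂)) + (𝟙 (w ≟ₜ s₁′) + 𝟙 (w ≟ₜ s₂′))
      ≡⟨ interchange (𝟙 (w ≟ₜ s₁)) (𝟙 (w ≟ₜ s₂)) (𝟙 (w ≟ₜ s₁′)) (𝟙 (w ≟ₜ s₂′)) ⟩
    (𝟙 (w ≟ₜ s₁) + 𝟙 (w ≟ₜ s₁′)) + (𝟙 (w ≟ₜ s₂) + 𝟙 (w ≟ₜ s₂′))
      ≡⟨ cong₂ _+_ (sym (𝟙-⊎ (w ≟ₜ s₁) (w ≟ₜ s₁′) (u≢v ∘ first-differs)))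
                   (sym (𝟙-⊎ (w ≟ₜ s₂) (w ≟ₜ s₂′) (u≢v ∘ first-differs))) ⟩
    𝟙 ((w ≟ₜ s₁) ⊎-dec (w ≟ₜ s₁′)) + 𝟙 ((w ≟ₜ s₂) ⊎-dec (w ≟ₜ s₂′)) ∎
    where
    open ≡-Reasoning
    w = window j i
    a = turn j (position j i)
    b = turn j (suc (position j i))
    t = Zig.window-Triangle j (position j i)
    s₁ s₁′ s₂ s₂′ : Triple
    s₁ = u , v , z₁
    s₁′ = v , u , z₂
    s₂ = u , v , z₂
    s₂′ = v , u , z₁
    first-differs : ∀ {x y} → w ≡ (u , v , x) × w ≡ (v , u , y) → u ≡ v
    first-differs (e , e′) = cong proj₁ (trans (sym e) e′)

  Occ-pair : ∀ {u v} → Adj u v → Occ τ u v + Occ τ v u ≡ 2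
  Occ-pair {u} {v} adj with edge-apexes adj
  ... | z₁ , z₂ , t₁ , t₂ , z₁≢z₂ , apex = begin
    Occ τ u v + Occ τ v u
      ≡⟨ cong₂ _+_ (Occ≡sum u v) (Occ≡sum v u) ⟩
    ∑∑ (λ j i → traversal j i u v) + ∑∑ (λ j i → traversal j i v u)
      ≡⟨ ∑∑-distrib-+ (λ j i → traversal j i u v) (λ j i → traversal j i v u) ⟨
    ∑∑ (λ j i → traversal j i u v + traversal j i v u)
      ≡⟨ sum-cong-≗ (λ j → sum-cong-≗ (λ i → traversals-split j i (proj₁ adj) z₁≢z₂ apex)) ⟩
    ∑∑ (λ j i → 𝟙 (F₁.visits? j i) + 𝟙 (F₂.visits? j i))
      ≡⟨ ∑∑-distrib-+ (λ j i → 𝟙 (F₁.visits? j i)) (λ j i → 𝟙 (F₂.visits? j i)) ⟩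
    ∑∑ (λ j i → 𝟙 (F₁.visits? j i)) + ∑∑ (λ j i → 𝟙 (F₂.visits? j i))
      ≡⟨ cong₂ _+_ F₁.visited-once F₂.visited-once ⟩
    2 ∎
    where
    open ≡-Reasoning
    ∑∑ : (∀ j → Fin (len (τ j)) → ℕ) → ℕ
    ∑∑ f = ∑[ j < K ] ∑[ i < len (τ j) ] f j i
    ∑∑-distrib-+ : ∀ f g → ∑∑ (λ j i → f j i + g j i) ≡ ∑∑ f + ∑∑ g
    ∑∑-distrib-+ f g =
      trans (sum-cong-≗ (λ j → ∑-distrib-+ (f j) (g j))) (∑-distrib-+ (λ j → sum (f j)) (λ j → sum (g j)))
    module F₁ = FlipPair {u , v , z₁} {v , u , z₂} (refl , refl , t₁ , Triangle-swap₁₂ t₂ , ≢-sym z₁≢z₂)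
    module F₂ = FlipPair {u , v , z₂} {v , u , z₁} (refl , refl , t₂ , Triangle-swap₁₂ t₁ , z₁≢z₂)

  𝟙-TypeIIFrom : ∀ {u v} → Adj u v → 𝟙 (TypeIIFrom? Γ τ u v) ≡ 𝟙 ((Occ τ u v ℕ.≟ 2) ×-dec (Occ τ v u ℕ.≟ 0))
  𝟙-TypeIIFrom {u} {v} adj =
    trans (𝟙-× (Adj? Γ τ u v) _) (trans (cong (_* _) (𝟙-yes (Adj? Γ τ u v) adj)) (*-identityˡ _))

  pair-balance : ∀ u v → Occ τ u v + 2 * 𝟙 (TypeIIFrom? Γ τ v u) ≡ Occ τ v u + 2 * 𝟙 (TypeIIFrom? Γ τ u v)
  pair-balance u v = by-adjacency (Adj? Γ τ u v)
    where
    open ≡-Reasoning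
    by-adjacency : Dec (Adj u v) →
                   Occ τ u v + 2 * 𝟙 (TypeIIFrom? Γ τ v u) ≡ Occ τ v u + 2 * 𝟙 (TypeIIFrom? Γ τ u v)
    by-adjacency (yes adj) = begin
      Occ τ u v + 2 * 𝟙 (TypeIIFrom? Γ τ v u)
        ≡⟨ cong (λ x → Occ τ u v + 2 * x) (𝟙-TypeIIFrom (Adj-sym adj)) ⟩
      Occ τ u v + 2 * 𝟙 ((Occ τ v u ℕ.≟ 2) ×-dec (Occ τ u v ℕ.≟ 0))
        ≡⟨ balance-of-two (Occ τ u v) (Occ τ v u) (Occ-pair adj) ⟩
      Occ τ v u + 2 * 𝟙 ((Occ τ u v ℕ.≟ 2) ×-dec (Occ τ v u ℕ.≟ 0))
        ≡⟨ cong (λ x → Occ τ v u + 2 * x) (𝟙-TypeIIFrom adj) ⟨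
      Occ τ v u + 2 * 𝟙 (TypeIIFrom? Γ τ u v) ∎
    by-adjacency (no ¬adj) = begin
      Occ τ u v + 2 * 𝟙 (TypeIIFrom? Γ τ v u)
        ≡⟨ cong₂ (λ x y → x + 2 * y) (Occ-nonadjacent ¬adj) (𝟙-no (TypeIIFrom? Γ τ v u) (¬adj ∘ Adj-sym ∘ proj₁)) ⟩
      0
        ≡⟨ cong₂ (λ x y → x + 2 * y) (Occ-nonadjacent (¬adj ∘ Adj-sym)) (𝟙-no (TypeIIFrom? Γ τ u v) (¬adj ∘ proj₁)) ⟨
      Occ τ v u + 2 * 𝟙 (TypeIIFrom? Γ τ u v) ∎

  entering≡leaving : ∀ v → #enter Γ τ v ≡ #leave Γ τ v
  entering≡leaving v = begin
    #enter Γ τ v   ≡⟨ count≡sum (λ u → TypeIIFrom? Γ τ u v) ⟩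
    sum entering   ≡⟨ *-cancelˡ-≡ _ _ 2 (+-cancelˡ-≡ (∑[ u < n ] Occ τ v u) _ _ totals) ⟨
    sum leaving    ≡⟨ count≡sum (λ w → TypeIIFrom? Γ τ v w) ⟨
    #leave Γ τ v   ∎
    where
    open ≡-Reasoning
    entering leaving : Fin n → ℕ
    entering u = 𝟙 (TypeIIFrom? Γ τ u v)
    leaving  u = 𝟙 (TypeIIFrom? Γ τ v u)
    totals : ∑[ u < n ] Occ τ v u + 2 * sum leaving ≡ ∑[ u < n ] Occ τ v u + 2 * sum entering
    totals = begin
      ∑[ u < n ] Occ τ v u + 2 * sum leaving
        ≡⟨ cong (_+ 2 * sum leaving) (flow-conservation v) ⟨
      ∑[ u < n ] Occ τ u v + 2 * sum leaving
        ≡⟨ cong (∑[ u < n ] Occ τ u v +_) (*-distribˡ-sum 2 leaving) ⟩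
      ∑[ u < n ] Occ τ u v + ∑[ u < n ] (2 * leaving u)
        ≡⟨ ∑-distrib-+ (λ u → Occ τ u v) (λ u → 2 * leaving u) ⟨
      ∑[ u < n ] (Occ τ u v + 2 * leaving u)
        ≡⟨ sum-cong-≗ (λ u → pair-balance u v) ⟩
      ∑[ u < n ] (Occ τ v u + 2 * entering u)
        ≡⟨ ∑-distrib-+ (λ u → Occ τ v u) (λ u → 2 * entering u) ⟩
      ∑[ u < n ] Occ τ v u + ∑[ u < n ] (2 * entering u)
        ≡⟨ cong (∑[ u < n ] Occ τ v u +_) (*-distribˡ-sum 2 entering) ⟨
      ∑[ u < n ] Occ τ v u + 2 * sum entering ∎

lemma1 : ∀ {n m : ℕ} (Γ : Triangulation n m) {K : ℕ} (τ : Fin K → CycSeq n) →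
    IsZOrientation Γ τ → ∀ (v : Fin n) → VertexTypeII Γ τ v →
    #enter Γ τ v ≡ #leave Γ τ v
lemma1 Γ τ oz v _ = ZOrientation.entering≡leaving Γ τ oz v
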